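{- Let $X,Y$ be sets. Every directionally atomic relation $R : \mathcal{P}(X)\to\!\!\!\!\!\mapsto\mathcal{P}(Y)$ is equal to $\mathrm{Low}(S)$ for some relation $S : X\to\!\!\!\!\!\mapsto Y$.
   Context: A relation $S : X\to\!\!\!\!\!\mapsto Y$ is a subset of $X\times Y$. The lower relation $\mathrm{Low}(S) : \mathcal{P}(X)\to\!\!\!\!\!\mapsto\mathcal{P}(Y)$ is $A\mathrel{\mathrm{Low}(S)}B$ iff $\forall a\in A\ \exists b\in B.\ a\mathrel{S}b$. Powersets are ordered by inclusion; their atoms are the singletons. A relation $R : \mathcal{B}\to\!\!\!\!\!\mapsto\mathcal{B}'$ between complete atomic Boolean algebras is directionally atomic if it is a bimodule ($p'\sqsubseteq p\mathrel{R}q\sqsubseteq q'\Rightarrow p'\mathrel{R}q'$), left-disjunctive (for any family $(a_i)_{i\in I}$, $a_i\mathrel{R}b$ for all $i$ implies $(\bigsqcup_i a_i)\mathrel{R}b$) and atomic-founded (if $a$ is an atom and $a\mathrel{R}b$ there is an atom $b'\sqsubseteq b$ with $a\mathrel{R}b'$). -}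

module Defs where

open import Level using (0ℓ)
open import Data.Product using (Σ; ∃; _×_; _,_)
open import Relation.Unary using (Pred; _⊆_; _∈_)
open import Relation.Binary.PropositionalEquality using (_≡_)
open import Function.Bundles using (_⇔_)

𝒫 : Set → Set₁
𝒫 X = Pred X 0ℓ

Rel⇸ : Set → Set → Set₁
Rel⇸ X Y = X → Y → Set

｛_｝ : {X : Set} → X → 𝒫 X
｛ x ｝ = λ x′ → x ≡ x′

_≐_ : {X : Set} → 𝒫 X → 𝒫 X → Set
A ≐ B = (A ⊆ B) × (B ⊆ A)

-- Atoms of the powerset algebra are the singletons.
IsAtom : {X : Set} → 𝒫 X → Set
IsAtom {X} a = Σ X λ x → a ≐ ｛ x ｝

⋃ : {X : Set} (I : Set) → (I → 𝒫 X) → 𝒫 X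
⋃ I a = λ x → Σ I λ i → x ∈ a i

Low : {X Y : Set} → Rel⇸ X Y → 𝒫 X → 𝒫 Y → Set
Low S A B = ∀ {a} → a ∈ A → Σ _ λ b → b ∈ B × S a b

IsBimodule : {X Y : Set} → (𝒫 X → 𝒫 Y → Set) → Set₁
IsBimodule R = ∀ {p p′ q q′} → p′ ⊆ p → R p q → q ⊆ q′ → R p′ q′

IsLeftDisjunctive : {X Y : Set} → (𝒫 X → 𝒫 Y → Set) → Set₁
IsLeftDisjunctive R = ∀ (I : Set) (a : I → _) b → (∀ i → R (a i) b) → R (⋃ I a) b

IsAtomicFounded : {X Y : Set} → (𝒫 X → 𝒫 Y → Set) → Set₁
IsAtomicFounded R = ∀ a b → IsAtom a → R a b → Σ _ λ b′ → IsAtom b′ × b′ ⊆ b × R a b′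

record DirectionallyAtomic {X Y : Set} (R : 𝒫 X → 𝒫 Y → Set) : Set₁ where
  field
    bimodule         : IsBimodule R
    leftDisjunctive  : IsLeftDisjunctive R
    atomicFounded    : IsAtomicFounded R

_≗ʳ_ : {X Y : Set} → (𝒫 X → 𝒫 Y → Set) → (𝒫 X → 𝒫 Y → Set) → Set₁
R ≗ʳ R′ = ∀ A B → R A B ⇔ R′ A B

{-# OPTIONS --safe #-}
-- R is determined by its values on pairs of singletons, S x y := R {x} {y}.
-- If R A B, then for a ∈ A restriction gives R {a} B, and atomic foundedness
-- picks y ∈ B with R {a} {y}; so R ⊆ Low S.  Conversely, A is the union of the
-- singletons {a}, a ∈ A, each of which is R-related to B by enlarging {y} to B,
-- so left disjunctivity gives R A B; hence Low S ⊆ R.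
module Submission where

open import Defs
open import Data.Product using (Σ; _,_; proj₁)
open import Function.Base using (id; _∘_)
open import Function.Bundles using (mk⇔)
open import Relation.Binary.PropositionalEquality using (refl)
open import Relation.Unary using (_⊆_; _∈_)

pointRel : {X Y : Set} → (𝒫 X → 𝒫 Y → Set) → Rel⇸ X Y
pointRel R x y = R ｛ x ｝ ｛ y ｝

singleton-isAtom : {X : Set} (x : X) → IsAtom ｛ x ｝
singleton-isAtom x = x , id , id

∈⇒singleton-⊆ : {X : Set} {A : 𝒫 X} {x : X} → x ∈ A → ｛ x ｝ ⊆ A
∈⇒singleton-⊆ x∈A refl = x∈A

⊆-⋃-singletons : {X : Set} (A : 𝒫 X) → A ⊆ ⋃ (Σ X A) (｛_｝ ∘ proj₁)
⊆-⋃-singletons A {x} x∈A = (x , x∈A) , refl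

module _ {X Y : Set} {R : 𝒫 X → 𝒫 Y → Set} (bimodule : IsBimodule R) where

  R⇒Low-pointRel : IsAtomicFounded R → ∀ {A B} → R A B → Low (pointRel R) A B
  R⇒Low-pointRel atomicFounded {A} {B} r {a} a∈A
    with atomicFounded ｛ a ｝ B (singleton-isAtom a)
                       (bimodule (∈⇒singleton-⊆ a∈A) r id)
  ... | _ , (y , b′⊆｛y｝ , ｛y｝⊆b′) , b′⊆B , r′ =
    y , b′⊆B (｛y｝⊆b′ refl) , bimodule id r′ b′⊆｛y｝

  Low-pointRel⇒R : IsLeftDisjunctive R → ∀ {A B} → Low (pointRel R) A B → R A B
  Low-pointRel⇒R leftDisjunctive {A} {B} low =
    bimodule (⊆-⋃-singletons A) (leftDisjunctive (Σ X A) (｛_｝ ∘ proj₁) B singleton-R) id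
    where
    singleton-R : ∀ ((a , a∈A) : Σ X A) → R ｛ a ｝ B
    singleton-R (a , a∈A) with low a∈A
    ... | b , b∈B , r = bimodule id r (∈⇒singleton-⊆ b∈B)

mainTheorem11 : {X Y : Set} (R : 𝒫 X → 𝒫 Y → Set) → DirectionallyAtomic R →
    Σ (Rel⇸ X Y) (λ S → R ≗ʳ Low S)
mainTheorem11 R da = pointRel R , λ A B →
  mk⇔ (R⇒Low-pointRel bimodule atomicFounded) (Low-pointRel⇒R bimodule leftDisjunctive)
  where open DirectionallyAtomic da
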